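{- Let $q\ge3$, $n\ge1$, and let $(T_+,T_-)$ be a pair of disjoint subsets of $\mathbb{Z}_q^n$. Then the following are equivalent: (D2) $T_+$ and $T_-$ are codes with code distance $4$, and for every $i\in\{1,\ldots,n\}$ the $i$-projection of $(T_+,T_-)$ is a perfect bitrade in $H(n-1,q)$; (D3) for every vertex $x$ of $H(n,q)$, $w_{T_+}(x)=w_{T_- }(x)\le1$.
   Context: $H(m,q)$ is the Hamming graph on $\mathbb{Z}_q^m$ (adjacent iff differing in exactly one coordinate), $d$ the Hamming distance, $S_i(x)=\{y:d(x,y)=i\}$, $B(x)=\{y:d(x,y)\le1\}$. A set of vertices is a code with code distance $d$ if any two distinct elements are at distance at least $d$. For $Z\subseteq\mathbb{Z}_q^n$, $w_Z(x)=|S_0(x)\cap Z|+|S_1(x)\cap Z|+\frac{2}{n}|S_2(x)\cap Z|$. For $x=(x_1,\dots,x_{n-1})\in\mathbb{Z}_q^{n-1}$, $x^a_i=(x_1,\ldots,x_{i-1},a,x_i,\ldots,x_{n-1})$. The $i$-projection of $C\subseteq\mathbb{Z}_q^n$ is $\{x\in\mathbb{Z}_q^{n-1}: x^a_i\in C\text{ for some }a\in\mathbb{Z}_q\}$; with $A_\pm$ the $i$-projections of $T_\pm$, the $i$-projection of the pair $(T_+,T_-)$ is $(A_+\setminus A_-,A_-\setminus A_+)$. A perfect bitrade in $H(m,q)$ is a pair $(P_+,P_-)$ of disjoint vertex sets with $|B(x)\cap P_+|=|B(x)\cap P_-|\le1$ for every vertex $x$. -}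

module Defs where

open import Data.Nat using (ℕ; zero; suc; _+_; _*_; _≤_; _≡ᵇ_; _≤ᵇ_)
open import Data.Bool using (Bool; true; false; _∧_; not; if_then_else_)
open import Data.Fin using (Fin)
open import Data.Fin.Properties using (_≟_)
open import Data.Vec using (Vec; []; _∷_; insertAt)
open import Data.List using (List; [_]; map; concatMap; allFin; filter; length)
open import Data.Bool.ListAction using (any)
open import Data.Integer using (+_)
open import Data.Rational using (ℚ; _/_) renaming (_+_ to _+ℚ_; _*_ to _*ℚ_; _≤_ to _≤ℚ_)
open import Data.Product using (_×_)
open import Relation.Nullary using (does; ¬_)
open import Relation.Binary.PropositionalEquality using (_≡_; _≢_)

V : ℕ → ℕ → Set
V q n = Vec (Fin q) n

VSet : ℕ → ℕ → Set
VSet q n = V q n → Bool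

allV : ∀ q n → List (V q n)
allV q zero    = [ [] ]
allV q (suc n) = concatMap (λ a → map (a ∷_) (allV q n)) (allFin q)

dist : ∀ {q n} → V q n → V q n → ℕ
dist []       []       = 0
dist (a ∷ x) (b ∷ y) = (if does (a ≟ b) then 0 else 1) + dist x y

card : ∀ {q n} → VSet q n → ℕ
card {q} {n} P = length (filter (λ y → Data.Bool.T? (P y)) (allV q n))

sphereCount : ∀ {q n} → VSet q n → V q n → ℕ → ℕ
sphereCount Z x i = card (λ y → Z y ∧ (dist x y ≡ᵇ i))

ballCount : ∀ {q n} → VSet q n → V q n → ℕ
ballCount Z x = card (λ y → Z y ∧ (dist x y ≤ᵇ 1))

ι : ℕ → ℚ
ι k = (+ k) / 1

-- w_Z(x) = |S_0(x)∩Z| + |S_1(x)∩Z| + (2/n)|S_2(x)∩Z|, for Z ⊆ Z_q^n with n = suc m ≥ 1.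
w : ∀ {q m} → VSet q (suc m) → V q (suc m) → ℚ
w {q} {m} Z x = ι (sphereCount Z x 0) +ℚ ι (sphereCount Z x 1)
                 +ℚ ((+ 2) / suc m) *ℚ ι (sphereCount Z x 2)

Disjoint : ∀ {q n} → VSet q n → VSet q n → Set
Disjoint {q} {n} A B = ∀ (x : V q n) → ¬ (A x ≡ true × B x ≡ true)

IsCode : ∀ {q n} → ℕ → VSet q n → Set
IsCode {q} {n} d C = ∀ (x y : V q n) → C x ≡ true → C y ≡ true → x ≢ y → d ≤ dist x y

-- i-projection of C ⊆ Z_q^(m+1), i ∈ {1..m+1} represented by Fin (suc m);
-- x^a_i = insertAt x i a.
proj : ∀ {q m} → Fin (suc m) → VSet q (suc m) → VSet q m
proj {q} i C x = any (λ a → C (insertAt x i a)) (allFin q)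

projPair₊ projPair₋ : ∀ {q m} → Fin (suc m) → VSet q (suc m) → VSet q (suc m) → VSet q m
projPair₊ i T₊ T₋ x = proj i T₊ x ∧ not (proj i T₋ x)
projPair₋ i T₊ T₋ x = proj i T₋ x ∧ not (proj i T₊ x)

PerfectBitrade : ∀ {q n} → VSet q n → VSet q n → Set
PerfectBitrade {q} {n} P₊ P₋ =
  Disjoint P₊ P₋ ×
  (∀ (x : V q n) → (ballCount P₊ x ≡ ballCount P₋ x) × (ballCount P₊ x ≤ 1))

D2 : ∀ {q m} → VSet q (suc m) → VSet q (suc m) → Set
D2 {q} {m} T₊ T₋ =
  IsCode 4 T₊ × IsCode 4 T₋ ×
  (∀ (i : Fin (suc m)) → PerfectBitrade (projPair₊ i T₊ T₋) (projPair₋ i T₊ T₋))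

D3 : ∀ {q m} → VSet q (suc m) → VSet q (suc m) → Set
D3 {q} {m} T₊ T₋ =
  ∀ (x : V q (suc m)) → (w T₊ x ≡ w T₋ x) × (w T₊ x ≤ℚ ι 1)

module Submission where

-- Write N_Z(x) = n · w_Z(x) = n (|S₀(x) ∩ Z| + |S₁(x) ∩ Z|) + 2 |S₂(x) ∩ Z|, a natural number.
-- If Z is a code with distance 4, then N_Z(x) = n when the ball B(x) meets Z. Otherwise the
-- codewords at distance 2 from x differ from x in pairwise disjoint pairs of coordinates, so
-- N_Z(x) is the number of coordinates i in which one of them differs from x; these are exactly
-- the i for which the i-projection of Z meets the ball around x with its i-th coordinate deleted.
-- Hence N_Z ≤ n, and conversely N_Z ≤ n everywhere forces code distance 4.
-- For codes T₊ and T₋, the projection of a code meets a ball in at most one point, so the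
-- i-projection of (T₊, T₋) is a perfect bitrade exactly when the i-projections of T₊ and T₋ meet
-- the same balls; by the description of N this holds for every i exactly when N_{T₊} = N_{T₋}.

open import Defs
open import Data.Nat as ℕ using (ℕ; zero; suc; _+_; _*_; _≤_; _<_; z≤n; s≤s; _≤ᵇ_; _≡ᵇ_)
import Data.Nat.Properties as ℕ
open import Data.Bool using (Bool; true; false; _∧_; _∨_; not; T; if_then_else_)
open import Data.Bool.Properties using (T-≡)
open import Data.Bool.ListAction using (any)
open import Data.Fin using (Fin; zero; suc)
open import Data.Fin.Properties using (_≟_)
open import Data.Vec using (Vec; []; _∷_; insertAt; removeAt; lookup)
open import Data.Vec.Properties
  using (≡-dec; ∷-injectiveˡ; ∷-injectiveʳ; insertAt-lookup; insertAt-removeAt; removeAt-insertAt)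
open import Data.List using (List; []; _∷_; _++_; filter; length; map; concatMap; allFin; tabulate; cartesianProductWith)
open import Data.List.Properties using (length-tabulate; length-filter; filter-none; filter-all; filter-complete; filter-≐)
open import Data.List.Membership.Propositional using (_∈_; find; lose)
open import Data.List.Membership.Propositional.Properties
  using (∈-filter⁻; ∈-filter⁺; ∈-allFin; ∈-cartesianProductWith⁺)
open import Data.List.Relation.Unary.Unique.Propositional.Properties as Unique using (allFin⁺; cartesianProductWith⁺)
open import Data.List.Relation.Unary.Any using (here; there)
open import Data.List.Relation.Unary.Any.Properties using (any⁺; any⁻)
open import Data.List.Relation.Unary.All as All using (All; []; _∷_)
open import Data.List.Relation.Unary.AllPairs using ([]; _∷_)
open import Data.List.Relation.Unary.Unique.Propositional using (Unique)
open import Data.Product using (Σ-syntax; _×_; _,_; proj₁; proj₂)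
open import Data.Empty using (⊥; ⊥-elim)
open import Data.Rational as ℚ using (ℚ; toℚᵘ)
open import Function.Base using (_∘_)
open import Function.Bundles using (_⇔_; mk⇔; Equivalence)
open import Relation.Nullary using (¬_; Dec; yes; no; does)
open import Relation.Nullary.Decidable using (T?; map′)
open import Relation.Binary.PropositionalEquality

open import Algebra.Properties.CommutativeSemigroup ℕ.+-commutativeSemigroup
  using () renaming (interchange to +-interchange; x∙yz≈y∙xz to +-exchange)

open Equivalence using (to; from)
open import Function.Properties.Equivalence using () renaming (trans to ⇔-trans; sym to ⇔-sym)

-- Boolean search and counting in a list

false≢true : false ≢ true
false≢true ()

module _ {A : Set} where

  any-witness : ∀ (p : A → Bool) xs → any p xs ≡ true → Σ[ x ∈ A ] x ∈ xs × p x ≡ true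
  any-witness p xs e with find (any⁻ p xs (from T-≡ e))
  ... | x , x∈xs , px = x , x∈xs , to T-≡ px

  any-of-witness : ∀ (p : A → Bool) {xs x} → x ∈ xs → p x ≡ true → any p xs ≡ true
  any-of-witness p x∈xs px = to T-≡ (any⁺ p (lose x∈xs (from T-≡ px)))

  search : ∀ xs → (∀ x → x ∈ xs) → ∀ (p : A → Bool) → Dec (Σ[ x ∈ A ] p x ≡ true)
  search xs complete p with any p xs in e
  ... | true  = yes (let x , _ , px = any-witness p xs e in x , px)
  ... | false = no λ (x , px) → false≢true (trans (sym e) (any-of-witness p (complete x) px))

  count : List A → (A → Bool) → ℕ
  count xs P = length (filter (λ x → T? (P x)) xs)

  count-pos : ∀ {xs} P {x} → x ∈ xs → P x ≡ true → 1 ≤ count xs P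
  count-pos {y ∷ xs} P (here refl) px with P y
  ... | true = s≤s z≤n
  count-pos {y ∷ xs} P (there x∈xs) px with P y
  ... | true  = s≤s z≤n
  ... | false = count-pos P x∈xs px

  count-pos-witness : ∀ xs P → 1 ≤ count xs P → Σ[ x ∈ A ] x ∈ xs × P x ≡ true
  count-pos-witness (y ∷ xs) P pos with P y in py
  ... | true  = y , here refl , py
  ... | false with count-pos-witness xs P pos
  ... | x , x∈xs , px = x , there x∈xs , px

  count-none : ∀ xs P → (∀ x → P x ≡ true → ⊥) → count xs P ≡ 0
  count-none xs P none = cong length (filter-none (λ x → T? (P x)) (All.universal (λ x px → none x (to T-≡ px)) xs))

  count-every : ∀ xs P → (∀ x → P x ≡ true) → count xs P ≡ length xs
  count-every xs P every = cong length (filter-all (λ x → T? (P x)) (All.universal (λ x → from T-≡ (every x)) xs))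

  count-≤-length : ∀ xs P → count xs P ≤ length xs
  count-≤-length xs P = length-filter (λ x → T? (P x)) xs

  count-≡length⇒every : ∀ xs P → count xs P ≡ length xs → ∀ {x} → x ∈ xs → P x ≡ true
  count-≡length⇒every xs P full x∈xs =
    to T-≡ (proj₂ (∈-filter⁻ (λ x → T? (P x)) {xs = xs}
      (subst (_ ∈_) (sym (filter-complete (λ x → T? (P x)) full)) x∈xs)))

  count-cong : ∀ xs P Q → (∀ x → P x ≡ true ⇔ Q x ≡ true) → count xs P ≡ count xs Q
  count-cong xs P Q P⇔Q = cong length (filter-≐ (λ x → T? (P x)) (λ x → T? (Q x))
    ((λ {x} px → from T-≡ (to (P⇔Q x) (to T-≡ px))) , (λ {x} qx → from T-≡ (from (P⇔Q x) (to T-≡ qx)))) xs)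

  count-∨ : ∀ xs P Q → (∀ x → P x ≡ true → Q x ≡ true → ⊥) →
            count xs (λ x → P x ∨ Q x) ≡ count xs P + count xs Q
  count-∨ []       P Q disjoint = refl
  count-∨ (y ∷ xs) P Q disjoint with P y in py | Q y in qy
  ... | true  | true  = ⊥-elim (disjoint y py qy)
  ... | true  | false = cong suc (count-∨ xs P Q disjoint)
  ... | false | true  = trans (cong suc (count-∨ xs P Q disjoint)) (sym (ℕ.+-suc _ _))
  ... | false | false = count-∨ xs P Q disjoint

  count-≤1 : ∀ xs P → Unique xs → (∀ x y → P x ≡ true → P y ≡ true → x ≡ y) → count xs P ≤ 1
  count-≤1 []       P []             functional = z≤n
  count-≤1 (y ∷ xs) P (y∉xs ∷ uniq) functional with P y in py
  ... | false = count-≤1 xs P uniq functional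
  ... | true  = s≤s (ℕ.≤-reflexive (count-none-after xs y∉xs))
    where
    count-none-after : ∀ zs → All (y ≢_) zs → count zs P ≡ 0
    count-none-after []       []          = refl
    count-none-after (z ∷ zs) (y≢z ∷ y∉zs) with P z in pz
    ... | true  = ⊥-elim (y≢z (functional y z py pz))
    ... | false = count-none-after zs y∉zs

  count-≡1 : ∀ xs P → Unique xs → ∀ {x} → x ∈ xs → P x ≡ true → (∀ y → P y ≡ true → y ≡ x) →
             count xs P ≡ 1
  count-≡1 xs P uniq x∈xs px unique =
    ℕ.≤-antisym (count-≤1 xs P uniq (λ y z py pz → trans (unique y py) (sym (unique z pz)))) (count-pos P x∈xs px)

  count-≥2 : ∀ xs P → Unique xs → ∀ {x y} → x ∈ xs → y ∈ xs → x ≢ y →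
             P x ≡ true → P y ≡ true → 2 ≤ count xs P
  count-≥2 (z ∷ xs) P (_ ∷ uniq) x∈ y∈ x≢y px py with P z in pz
  count-≥2 (z ∷ xs) P (_ ∷ uniq) (here refl) (here refl) x≢y px py | _     = ⊥-elim (x≢y refl)
  count-≥2 (z ∷ xs) P (_ ∷ uniq) (here refl) (there y∈) x≢y px py | true  = s≤s (count-pos P y∈ py)
  count-≥2 (z ∷ xs) P (_ ∷ uniq) (there x∈) (here refl) x≢y px py | true  = s≤s (count-pos P x∈ px)
  count-≥2 (z ∷ xs) P (_ ∷ uniq) (there x∈) (there y∈)  x≢y px py | true  =
    ℕ.m≤n⇒m≤1+n (count-≥2 xs P uniq x∈ y∈ x≢y px py)
  count-≥2 (z ∷ xs) P (_ ∷ uniq) (there x∈) (there y∈)  x≢y px py | false =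
    count-≥2 xs P uniq x∈ y∈ x≢y px py
  count-≥2 (z ∷ xs) P (_ ∷ uniq) (here refl) _          x≢y px py | false with () ← trans (sym px) pz
  count-≥2 (z ∷ xs) P (_ ∷ uniq) (there x∈) (here refl) x≢y px py | false with () ← trans (sym py) pz

-- The Hamming space

module _ {q : ℕ} where

  coordDist : Fin q → Fin q → ℕ
  coordDist a b = if does (a ≟ b) then 0 else 1

  differ : Fin q → Fin q → Bool
  differ a b = not (does (a ≟ b))

  coordDist-≤1 : ∀ a b → coordDist a b ≤ 1
  coordDist-≤1 a b with a ≟ b
  ... | yes _ = z≤n
  ... | no  _ = s≤s z≤n

  coordDist-self : ∀ a → coordDist a a ≡ 0
  coordDist-self a with a ≟ a
  ... | yes _   = refl
  ... | no  a≢a = ⊥-elim (a≢a refl)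

  coordDist-sym : ∀ a b → coordDist a b ≡ coordDist b a
  coordDist-sym a b with a ≟ b | b ≟ a
  ... | yes _   | yes _   = refl
  ... | no  _   | no  _   = refl
  ... | yes a≡b | no  b≢a = ⊥-elim (b≢a (sym a≡b))
  ... | no  a≢b | yes b≡a = ⊥-elim (a≢b (sym b≡a))

  coordDist-triangle : ∀ a b c → coordDist a c ≤ coordDist a b + coordDist b c
  coordDist-triangle a b c with a ≟ c | a ≟ b | b ≟ c
  ... | yes _   | _        | _        = z≤n
  ... | no  _   | no  _    | _        = s≤s z≤n
  ... | no  _   | yes _    | no  _    = s≤s z≤n
  ... | no  a≢c | yes refl | yes refl = ⊥-elim (a≢c refl)

  differ⇒coordDist≡1 : ∀ a b → differ a b ≡ true → coordDist a b ≡ 1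
  differ⇒coordDist≡1 a b d with a ≟ b
  ... | no _ = refl

  coordDist≡1⇒differ : ∀ a b → coordDist a b ≡ 1 → differ a b ≡ true
  coordDist≡1⇒differ a b d with a ≟ b
  ... | no _ = refl

  coordDist-≢ : ∀ {a b} → a ≢ b → coordDist a b ≡ 1
  coordDist-≢ {a} {b} a≢b with a ≟ b
  ... | yes a≡b = ⊥-elim (a≢b a≡b)
  ... | no  _   = refl

  dist-self : ∀ {n} (x : V q n) → dist x x ≡ 0
  dist-self []      = refl
  dist-self (a ∷ x) = cong₂ _+_ (coordDist-self a) (dist-self x)

  dist-sym : ∀ {n} (x y : V q n) → dist x y ≡ dist y x
  dist-sym []      []      = refl
  dist-sym (a ∷ x) (b ∷ y) = cong₂ _+_ (coordDist-sym a b) (dist-sym x y)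

  dist-triangle : ∀ {n} (x y z : V q n) → dist x z ≤ dist x y + dist y z
  dist-triangle []      []      []      = z≤n
  dist-triangle (a ∷ x) (b ∷ y) (c ∷ z) = begin
    coordDist a c + dist x z
      ≤⟨ ℕ.+-mono-≤ (coordDist-triangle a b c) (dist-triangle x y z) ⟩
    (coordDist a b + coordDist b c) + (dist x y + dist y z)
      ≡⟨ +-interchange (coordDist a b) (coordDist b c) (dist x y) (dist y z) ⟩
    (coordDist a b + dist x y) + (coordDist b c + dist y z) ∎
    where open ℕ.≤-Reasoning

  step-towards : ∀ {n} (t t′ : V q n) → t ≢ t′ →
                 Σ[ x ∈ V q n ] dist x t ≡ 1 × dist t t′ ≡ suc (dist x t′)
  step-towards []      []       t≢t′ = ⊥-elim (t≢t′ refl)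
  step-towards (a ∷ t) (b ∷ t′) t≢t′ with a ≟ b
  ... | no a≢b = b ∷ t ,
    cong₂ _+_ (coordDist-≢ (a≢b ∘ sym)) (dist-self t) ,
    cong (λ k → suc (k + dist t t′)) (sym (coordDist-self b))
  ... | yes refl with x , dxt , dtt′ ← step-towards t t′ (t≢t′ ∘ cong (a ∷_)) = a ∷ x ,
    trans (cong (_+ dist x t) (coordDist-self a)) dxt ,
    trans dtt′ (cong suc (sym (cong (_+ dist x t′) (coordDist-self a))))

  dist-insertAt : ∀ {n} (y z : V q n) i a b →
                  dist (insertAt y i a) (insertAt z i b) ≡ coordDist a b + dist y z
  dist-insertAt y       z       zero    a b = refl
  dist-insertAt (c ∷ y) (d ∷ z) (suc i) a b = begin
    coordDist c d + dist (insertAt y i a) (insertAt z i b) ≡⟨ cong (coordDist c d +_) (dist-insertAt y z i a b) ⟩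
    coordDist c d + (coordDist a b + dist y z)             ≡⟨ +-exchange (coordDist c d) (coordDist a b) (dist y z) ⟩
    coordDist a b + (coordDist c d + dist y z)             ∎
    where open ≡-Reasoning

  dist-removeAt : ∀ {n} (x y : V q (suc n)) i →
                  dist x y ≡ coordDist (lookup x i) (lookup y i) + dist (removeAt x i) (removeAt y i)
  dist-removeAt x y i = begin
    dist x y
      ≡⟨ sym (cong₂ dist (insertAt-removeAt x i) (insertAt-removeAt y i)) ⟩
    dist (insertAt (removeAt x i) i (lookup x i)) (insertAt (removeAt y i) i (lookup y i))
      ≡⟨ dist-insertAt (removeAt x i) (removeAt y i) i (lookup x i) (lookup y i) ⟩
    coordDist (lookup x i) (lookup y i) + dist (removeAt x i) (removeAt y i) ∎
    where open ≡-Reasoning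

  dist-insertAtʳ : ∀ {n} (x : V q (suc n)) z i a →
                   dist x (insertAt z i a) ≡ coordDist (lookup x i) a + dist (removeAt x i) z
  dist-insertAtʳ x z i a = trans (dist-removeAt x (insertAt z i a) i)
    (cong₂ (λ b v → coordDist (lookup x i) b + dist (removeAt x i) v) (insertAt-lookup z i a) (removeAt-insertAt z i a))

  dist-removeAt-≤ : ∀ {n} (x y : V q (suc n)) i → dist (removeAt x i) (removeAt y i) ≤ dist x y
  dist-removeAt-≤ x y i =
    ℕ.≤-trans (ℕ.m≤n+m _ (coordDist (lookup x i) (lookup y i))) (ℕ.≤-reflexive (sym (dist-removeAt x y i)))

  dist-removeAt-differ : ∀ {n} (x y : V q (suc n)) i → differ (lookup x i) (lookup y i) ≡ true →
                         dist x y ≡ suc (dist (removeAt x i) (removeAt y i))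
  dist-removeAt-differ x y i d = trans (dist-removeAt x y i)
    (cong (_+ dist (removeAt x i) (removeAt y i)) (differ⇒coordDist≡1 (lookup x i) (lookup y i) d))

  count-tabulate : ∀ {A : Set} n (f : Fin n → A) P → count (tabulate f) P ≡ count (allFin n) (λ i → P (f i))
  count-tabulate zero    f P = refl
  count-tabulate (suc n) f P with P (f zero)
  ... | true  = cong suc shift
    where shift = trans (count-tabulate n (λ i → f (suc i)) P) (sym (count-tabulate n suc (λ i → P (f i))))
  ... | false = trans (count-tabulate n (λ i → f (suc i)) P) (sym (count-tabulate n suc (λ i → P (f i))))

  count-differ≡dist : ∀ {n} (x y : V q n) → count (allFin n) (λ i → differ (lookup x i) (lookup y i)) ≡ dist x y
  count-differ≡dist []      []      = refl
  count-differ≡dist {suc n} (a ∷ x) (b ∷ y) with a ≟ b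
  ... | yes _ = trans (count-tabulate n suc _) (count-differ≡dist x y)
  ... | no  _ = cong suc (trans (count-tabulate n suc _) (count-differ≡dist x y))

  allV-cartesian : ∀ n → allV q (suc n) ≡ cartesianProductWith _∷_ (allFin q) (allV q n)
  allV-cartesian n = go (allFin q)
    where
    go : ∀ as → concatMap (λ a → map (a ∷_) (allV q n)) as ≡ cartesianProductWith _∷_ as (allV q n)
    go []       = refl
    go (a ∷ as) = cong (map (a ∷_) (allV q n) ++_) (go as)

  ∈-allV : ∀ {n} (x : V q n) → x ∈ allV q n
  ∈-allV []      = here refl
  ∈-allV (a ∷ x) =
    subst ((a ∷ x) ∈_) (sym (allV-cartesian _)) (∈-cartesianProductWith⁺ _∷_ (∈-allFin a) (∈-allV x))

  allV-unique : ∀ n → Unique (allV q n)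
  allV-unique zero    = [] ∷ []
  allV-unique (suc n) = subst Unique (sym (allV-cartesian n))
    (cartesianProductWith⁺ _∷_ (λ eq → ∷-injectiveˡ eq , ∷-injectiveʳ eq) (allFin⁺ q) (allV-unique n))

-- Weights as rationals with denominator n

module _ (m : ℕ) where

  open import Data.Integer as ℤ using (ℤ; +_)
  import Data.Integer.Properties as ℤ
  open import Data.Integer.Tactic.RingSolver using (solve-∀)
  open import Data.Rational.Properties
    using (toℚᵘ-fromℚᵘ; toℚᵘ-homo-+; toℚᵘ-homo-*; toℚᵘ-injective; toℚᵘ-cong; toℚᵘ-mono-≤; toℚᵘ-cancel-≤)
  open import Data.Rational.Unnormalised using (mkℚᵘ; _≃_; *≡*; *≤*)
  open import Data.Rational.Unnormalised.Properties
    using (≃-trans; ≃-sym; ≃-reflexive; +-cong; *-cong; ≤-respˡ-≃; ≤-respʳ-≃)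

  weight : ℕ → ℕ → ℕ → ℚ
  weight a b c = ι a ℚ.+ ι b ℚ.+ ((+ 2) ℚ./ suc m) ℚ.* ι c

  scaledWeight : ℕ → ℕ → ℕ → ℕ
  scaledWeight a b c = suc m * (a + b) + 2 * c

  n<scaledWeight-of-2≤ball : ∀ b c → 2 ≤ b → suc m < suc m * b + 2 * c
  n<scaledWeight-of-2≤ball b c 2≤b = begin-strict
    suc m           <⟨ ℕ.m<m+n (suc m) (s≤s z≤n) ⟩
    suc m + suc m   ≡⟨ cong (λ k → suc m + k) (ℕ.+-identityʳ (suc m)) ⟨
    2 * suc m       ≡⟨ ℕ.*-comm 2 (suc m) ⟩
    suc m * 2       ≤⟨ ℕ.*-monoʳ-≤ (suc m) 2≤b ⟩
    suc m * b       ≤⟨ ℕ.m≤m+n (suc m * b) (2 * c) ⟩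
    suc m * b + 2 * c ∎
    where open ℕ.≤-Reasoning

  n<scaledWeight-of-1≤ball-1≤sphere : ∀ b c → 1 ≤ b → 1 ≤ c → suc m < suc m * b + 2 * c
  n<scaledWeight-of-1≤ball-1≤sphere b c 1≤b 1≤c = begin-strict
    suc m             <⟨ ℕ.m<m+n (suc m) (s≤s (z≤n {1})) ⟩
    suc m + 2         ≡⟨ cong (λ k → k + 2) (ℕ.*-identityʳ (suc m)) ⟨
    suc m * 1 + 2 * 1 ≤⟨ ℕ.+-mono-≤ (ℕ.*-monoʳ-≤ (suc m) 1≤b) (ℕ.*-monoʳ-≤ 2 1≤c) ⟩
    suc m * b + 2 * c ∎
    where open ℕ.≤-Reasoning

  private
    toℚᵘ-ι : ∀ a → toℚᵘ (ι a) ≃ mkℚᵘ (+ a) 0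
    toℚᵘ-ι a = toℚᵘ-fromℚᵘ (mkℚᵘ (+ a) 0)

    +scaledWeight : ∀ a b c → + scaledWeight a b c ≡ + suc m ℤ.* (+ a ℤ.+ + b) ℤ.+ + 2 ℤ.* + c
    +scaledWeight a b c = trans (ℤ.pos-+ (suc m * (a + b)) (2 * c))
      (cong₂ ℤ._+_ (trans (ℤ.pos-* (suc m) (a + b)) (cong (+ suc m ℤ.*_) (ℤ.pos-+ a b))) (ℤ.pos-* 2 c))

    cross-multiplied : ∀ (A B C D : ℤ) →
      ((A ℤ.* + 1 ℤ.+ B ℤ.* + 1) ℤ.* D ℤ.+ (+ 2 ℤ.* C) ℤ.* + 1) ℤ.* D
      ≡ (D ℤ.* (A ℤ.+ B) ℤ.+ + 2 ℤ.* C) ℤ.* D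
    cross-multiplied = solve-∀

  toℚᵘ-weight : ∀ a b c → toℚᵘ (weight a b c) ≃ mkℚᵘ (+ scaledWeight a b c) m
  toℚᵘ-weight a b c = ≃-trans (toℚᵘ-homo-+ (ι a ℚ.+ ι b) (two/n ℚ.* ι c))
    (≃-trans (+-cong (≃-trans (toℚᵘ-homo-+ (ι a) (ι b)) (+-cong (toℚᵘ-ι a) (toℚᵘ-ι b)))
                     (≃-trans (toℚᵘ-homo-* two/n (ι c))
                              (*-cong (toℚᵘ-fromℚᵘ (mkℚᵘ (+ 2) m)) (toℚᵘ-ι c))))
             (*≡* eq))
    where
    two/n : ℚ
    two/n = (+ 2) ℚ./ suc m
    -- The equation *≡* unfolds to; m * 1 and + 0 come from the unit denominators of ι a, ι b, ι c.
    eq : ((+ a ℤ.* + 1 ℤ.+ + b ℤ.* + 1) ℤ.* + suc (m * 1) ℤ.+ (+ 2 ℤ.* + c) ℤ.* + 1) ℤ.* + suc m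
         ≡ + scaledWeight a b c ℤ.* + suc (m * 1 + 0)
    eq = begin
      ((+ a ℤ.* + 1 ℤ.+ + b ℤ.* + 1) ℤ.* + suc (m * 1) ℤ.+ (+ 2 ℤ.* + c) ℤ.* + 1) ℤ.* + suc m
        ≡⟨ cong (λ k → ((+ a ℤ.* + 1 ℤ.+ + b ℤ.* + 1) ℤ.* + suc k ℤ.+ (+ 2 ℤ.* + c) ℤ.* + 1) ℤ.* + suc m)
                (ℕ.*-identityʳ m) ⟩
      ((+ a ℤ.* + 1 ℤ.+ + b ℤ.* + 1) ℤ.* + suc m ℤ.+ (+ 2 ℤ.* + c) ℤ.* + 1) ℤ.* + suc m
        ≡⟨ cross-multiplied (+ a) (+ b) (+ c) (+ suc m) ⟩
      (+ suc m ℤ.* (+ a ℤ.+ + b) ℤ.+ + 2 ℤ.* + c) ℤ.* + suc m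
        ≡⟨ cong₂ ℤ._*_ (sym (+scaledWeight a b c))
                 (cong (λ k → + suc k) (sym (trans (ℕ.+-identityʳ (m * 1)) (ℕ.*-identityʳ m)))) ⟩
      + scaledWeight a b c ℤ.* + suc (m * 1 + 0) ∎
      where open ≡-Reasoning

  weight-≡⇔ : ∀ a b c a′ b′ c′ →
              weight a b c ≡ weight a′ b′ c′ ⇔ scaledWeight a b c ≡ scaledWeight a′ b′ c′
  weight-≡⇔ a b c a′ b′ c′ = mk⇔ cancel expand
    where
    cancel : weight a b c ≡ weight a′ b′ c′ → scaledWeight a b c ≡ scaledWeight a′ b′ c′
    cancel eq
      with ≃-trans (≃-sym (toℚᵘ-weight a b c)) (≃-trans (toℚᵘ-cong eq) (toℚᵘ-weight a′ b′ c′))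
    ... | *≡* e = ℕ.*-cancelʳ-≡ _ _ (suc m)
      (ℤ.+-injective (trans (ℤ.pos-* (scaledWeight a b c) (suc m))
                            (trans e (sym (ℤ.pos-* (scaledWeight a′ b′ c′) (suc m))))))
    expand : scaledWeight a b c ≡ scaledWeight a′ b′ c′ → weight a b c ≡ weight a′ b′ c′
    expand eq = toℚᵘ-injective (≃-trans (toℚᵘ-weight a b c)
      (≃-trans (≃-reflexive (cong (λ k → mkℚᵘ (+ k) m) eq)) (≃-sym (toℚᵘ-weight a′ b′ c′))))

  weight-≤1⇔ : ∀ a b c → weight a b c ℚ.≤ ι 1 ⇔ scaledWeight a b c ≤ suc m
  weight-≤1⇔ a b c = mk⇔ cancel expand
    where
    cancel : weight a b c ℚ.≤ ι 1 → scaledWeight a b c ≤ suc m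
    cancel le with ≤-respʳ-≃ (toℚᵘ-ι 1) (≤-respˡ-≃ (toℚᵘ-weight a b c) (toℚᵘ-mono-≤ le))
    ... | *≤* e =
      ℤ.drop‿+≤+ (subst₂ ℤ._≤_ (ℤ.*-identityʳ (+ scaledWeight a b c)) (ℤ.*-identityˡ (+ suc m)) e)
    expand : scaledWeight a b c ≤ suc m → weight a b c ℚ.≤ ι 1
    expand le = toℚᵘ-cancel-≤ (≤-respʳ-≃ (≃-sym (toℚᵘ-ι 1)) (≤-respˡ-≃ (≃-sym (toℚᵘ-weight a b c))
      (*≤* (subst₂ ℤ._≤_ (sym (ℤ.*-identityʳ (+ scaledWeight a b c))) (sym (ℤ.*-identityˡ (+ suc m)))
                         (ℤ.+≤+ le)))))

-- Balls, spheres and codes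

module _ {q n : ℕ} where

  ballMember : VSet q n → V q n → V q n → Bool
  ballMember Z x y = Z y ∧ (dist x y ≤ᵇ 1)

  sphereMember : VSet q n → V q n → ℕ → V q n → Bool
  sphereMember Z x k y = Z y ∧ (dist x y ≡ᵇ k)

  ballMember-intro : ∀ Z x y → Z y ≡ true → dist x y ≤ 1 → ballMember Z x y ≡ true
  ballMember-intro Z x y zy d rewrite zy = to T-≡ (ℕ.≤⇒≤ᵇ d)

  ballMember-elim : ∀ Z x y → ballMember Z x y ≡ true → Z y ≡ true × dist x y ≤ 1
  ballMember-elim Z x y p with Z y
  ... | true = refl , ℕ.≤ᵇ⇒≤ (dist x y) 1 (from T-≡ p)

  sphereMember-intro : ∀ Z x k y → Z y ≡ true → dist x y ≡ k → sphereMember Z x k y ≡ true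
  sphereMember-intro Z x k y zy d rewrite zy = to T-≡ (ℕ.≡⇒≡ᵇ (dist x y) k d)

  sphereMember-elim : ∀ Z x k y → sphereMember Z x k y ≡ true → Z y ≡ true × dist x y ≡ k
  sphereMember-elim Z x k y p with Z y
  ... | true = refl , ℕ.≡ᵇ⇒≡ (dist x y) k (from T-≡ p)

  ballCount≡sphereCount₀+sphereCount₁ : ∀ Z x → ballCount Z x ≡ sphereCount Z x 0 + sphereCount Z x 1
  ballCount≡sphereCount₀+sphereCount₁ Z x =
    trans (count-cong (allV q n) (ballMember Z x) _ (λ y → mk⇔ (trans (sym (split y))) (trans (split y))))
          (count-∨ (allV q n) (sphereMember Z x 0) (sphereMember Z x 1) disjoint)
    where
    split : ∀ y → ballMember Z x y ≡ (sphereMember Z x 0 y ∨ sphereMember Z x 1 y)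
    split y with Z y | dist x y
    ... | false | _             = refl
    ... | true  | zero          = refl
    ... | true  | suc zero      = refl
    ... | true  | suc (suc _)   = refl
    disjoint : ∀ y → sphereMember Z x 0 y ≡ true → sphereMember Z x 1 y ≡ true → ⊥
    disjoint y p₀ p₁
      with () ← trans (sym (proj₂ (sphereMember-elim Z x 0 y p₀))) (proj₂ (sphereMember-elim Z x 1 y p₁))

  BallMeets : VSet q n → V q n → Set
  BallMeets Z x = Σ[ t ∈ V q n ] Z t ≡ true × dist x t ≤ 1

  ballMeets? : ∀ Z x → Dec (BallMeets Z x)
  ballMeets? Z x = map′ (λ (t , p) → t , ballMember-elim Z x t p) (λ (t , zt , d) → t , ballMember-intro Z x t zt d)
    (search (allV q n) ∈-allV (ballMember Z x))

  ¬ballMeets⇒ballCount≡0 : ∀ Z x → ¬ BallMeets Z x → ballCount Z x ≡ 0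
  ¬ballMeets⇒ballCount≡0 Z x empty =
    count-none (allV q n) (ballMember Z x) (λ t p → empty (t , ballMember-elim Z x t p))

  code-≤3⇒≡ : ∀ {Z : VSet q n} → IsCode 4 Z → ∀ {t t′} → Z t ≡ true → Z t′ ≡ true →
              dist t t′ ≤ 3 → t ≡ t′
  code-≤3⇒≡ code {t} {t′} zt zt′ d with ≡-dec _≟_ t t′
  ... | yes t≡t′ = t≡t′
  ... | no  t≢t′ = ⊥-elim (ℕ.<⇒≱ (s≤s d) (code t t′ zt zt′ t≢t′))

  code⇒ballCount≡1 : ∀ {Z : VSet q n} → IsCode 4 Z → ∀ x → BallMeets Z x → ballCount Z x ≡ 1
  code⇒ballCount≡1 {Z} code x (t , zt , d) =
    count-≡1 (allV q n) (ballMember Z x) (allV-unique n) (∈-allV t) (ballMember-intro Z x t zt d) unique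
    where
    unique : ∀ y → ballMember Z x y ≡ true → y ≡ t
    unique y p with zy , dy ← ballMember-elim Z x y p = code-≤3⇒≡ code zy zt (begin
      dist y t            ≤⟨ dist-triangle y x t ⟩
      dist y x + dist x t ≤⟨ ℕ.+-mono-≤ (ℕ.≤-trans (ℕ.≤-reflexive (dist-sym y x)) dy) d ⟩
      2                   <⟨ ℕ.n<1+n 2 ⟩
      3                   ∎)
      where open ℕ.≤-Reasoning

  code⇒sphereCount₂≡0 : ∀ {Z : VSet q n} → IsCode 4 Z → ∀ x → BallMeets Z x → sphereCount Z x 2 ≡ 0
  code⇒sphereCount₂≡0 {Z} code x (t , zt , d) = count-none (allV q n) (sphereMember Z x 2) far
    where
    far : ∀ y → sphereMember Z x 2 y ≡ true → ⊥
    far y p = ℕ.<⇒≱ (s≤s (s≤s z≤n)) (subst (_≤ 1) dy (subst (λ v → dist x v ≤ 1) t≡y d))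
      where
      open ℕ.≤-Reasoning
      zy : Z y ≡ true
      zy = proj₁ (sphereMember-elim Z x 2 y p)
      dy : dist x y ≡ 2
      dy = proj₂ (sphereMember-elim Z x 2 y p)
      t≡y : t ≡ y
      t≡y = code-≤3⇒≡ code zt zy (begin
        dist t y            ≤⟨ dist-triangle t x y ⟩
        dist t x + dist x y ≤⟨ ℕ.+-mono-≤ (ℕ.≤-trans (ℕ.≤-reflexive (dist-sym t x)) d)
                                          (ℕ.≤-reflexive dy) ⟩
        3                   ∎)

  SupportsDisjoint : V q n → V q n → V q n → Set
  SupportsDisjoint x s t =
    ∀ i → differ (lookup x i) (lookup s i) ≡ true → differ (lookup x i) (lookup t i) ≡ true → ⊥

  covers : List (V q n) → V q n → Fin n → Bool
  covers ts x i = any (λ t → differ (lookup x i) (lookup t i)) ts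

  count-covers : ∀ x ts k → Unique ts → All (λ t → dist x t ≡ k) ts →
                 (∀ {s t} → s ∈ ts → t ∈ ts → s ≢ t → SupportsDisjoint x s t) →
                 count (allFin n) (covers ts x) ≡ k * length ts
  count-covers x []       k _               _          _        =
    trans (count-none (allFin n) (covers [] x) (λ _ ())) (sym (ℕ.*-zeroʳ k))
  count-covers x (t ∷ ts) k (t∉ts ∷ unique) (dt ∷ dts) disjoint = begin
    count (allFin n) (covers (t ∷ ts) x)
      ≡⟨ count-∨ (allFin n) (λ i → differ (lookup x i) (lookup t i)) (covers ts x) sharing ⟩
    count (allFin n) (λ i → differ (lookup x i) (lookup t i)) + count (allFin n) (covers ts x)
      ≡⟨ cong₂ _+_ (trans (count-differ≡dist x t) dt)
                   (count-covers x ts k unique dts (λ s∈ t∈ → disjoint (there s∈) (there t∈))) ⟩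
    k + k * length ts
      ≡⟨ ℕ.*-suc k (length ts) ⟨
    k * suc (length ts) ∎
    where
    open ≡-Reasoning
    sharing : ∀ i → differ (lookup x i) (lookup t i) ≡ true → covers ts x i ≡ true → ⊥
    sharing i dt dsi with s , s∈ts , ds ← any-witness _ ts dsi =
      disjoint (here refl) (there s∈ts) (All.lookup t∉ts s∈ts) i dt ds

-- The scaled weight n · w_Z(x) of a code

module _ {q m : ℕ} where

  sphere₂ : VSet q (suc m) → V q (suc m) → List (V q (suc m))
  sphere₂ Z x = filter (λ y → T? (sphereMember Z x 2 y)) (allV q (suc m))

  ∈-sphere₂⁻ : ∀ Z x {t} → t ∈ sphere₂ Z x → Z t ≡ true × dist x t ≡ 2
  ∈-sphere₂⁻ Z x {t} t∈ =
    sphereMember-elim Z x 2 t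
      (to T-≡ (proj₂ (∈-filter⁻ (λ y → T? (sphereMember Z x 2 y)) {xs = allV q (suc m)} t∈)))

  ∈-sphere₂⁺ : ∀ Z x {t} → Z t ≡ true → dist x t ≡ 2 → t ∈ sphere₂ Z x
  ∈-sphere₂⁺ Z x {t} zt d =
    ∈-filter⁺ (λ y → T? (sphereMember Z x 2 y)) (∈-allV t) (from T-≡ (sphereMember-intro Z x 2 t zt d))

  covered : VSet q (suc m) → V q (suc m) → Fin (suc m) → Bool
  covered Z x = covers (sphere₂ Z x) x

  coverage : VSet q (suc m) → V q (suc m) → ℕ
  coverage Z x = count (allFin (suc m)) (covered Z x)

  coverage≤n : ∀ Z x → coverage Z x ≤ suc m
  coverage≤n Z x = ℕ.≤-trans (count-≤-length (allFin (suc m)) (covered Z x))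
                             (ℕ.≤-reflexive (length-tabulate {n = suc m} (λ i → i)))

  code⇒supportsDisjoint : ∀ {Z : VSet q (suc m)} → IsCode 4 Z → ∀ x {s t} →
                          s ∈ sphere₂ Z x → t ∈ sphere₂ Z x → s ≢ t → SupportsDisjoint x s t
  code⇒supportsDisjoint {Z} code x {s} {t} s∈ t∈ s≢t i ds dt = s≢t (code-≤3⇒≡ code zs zt (begin
    dist s t
      ≡⟨ dist-removeAt s t i ⟩
    coordDist (lookup s i) (lookup t i) + dist (removeAt s i) (removeAt t i)
      ≤⟨ ℕ.+-mono-≤ (coordDist-≤1 (lookup s i) (lookup t i))
                    (dist-triangle (removeAt s i) (removeAt x i) (removeAt t i)) ⟩
    1 + (dist (removeAt s i) (removeAt x i) + dist (removeAt x i) (removeAt t i))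
      ≡⟨ cong (λ k → 1 + (k + _)) (dist-sym (removeAt s i) (removeAt x i)) ⟩
    1 + (dist (removeAt x i) (removeAt s i) + dist (removeAt x i) (removeAt t i))
      ≡⟨ cong₂ (λ k l → 1 + (k + l)) (at-distance-1 s∈ ds) (at-distance-1 t∈ dt) ⟩
    3 ∎))
    where
    open ℕ.≤-Reasoning
    zs : Z s ≡ true
    zs = proj₁ (∈-sphere₂⁻ Z x s∈)
    zt : Z t ≡ true
    zt = proj₁ (∈-sphere₂⁻ Z x t∈)
    at-distance-1 : ∀ {u} → u ∈ sphere₂ Z x → differ (lookup x i) (lookup u i) ≡ true →
                    dist (removeAt x i) (removeAt u i) ≡ 1
    at-distance-1 {u} u∈ du =
      ℕ.suc-injective (trans (sym (dist-removeAt-differ x u i du)) (proj₂ (∈-sphere₂⁻ Z x u∈)))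

  code⇒coverage≡2*sphereCount₂ : ∀ {Z : VSet q (suc m)} → IsCode 4 Z → ∀ x →
                                 coverage Z x ≡ 2 * sphereCount Z x 2
  code⇒coverage≡2*sphereCount₂ {Z} code x = count-covers x (sphere₂ Z x) 2
    (Unique.filter⁺ (λ y → T? (sphereMember Z x 2 y)) (allV-unique (suc m)))
    (All.tabulate (λ t∈ → proj₂ (∈-sphere₂⁻ Z x t∈)))
    (code⇒supportsDisjoint code x)

  scaledWeightAt : VSet q (suc m) → V q (suc m) → ℕ
  scaledWeightAt Z x = scaledWeight m (sphereCount Z x 0) (sphereCount Z x 1) (sphereCount Z x 2)

  w≡⇔scaledWeightAt≡ : ∀ A B x → w A x ≡ w B x ⇔ scaledWeightAt A x ≡ scaledWeightAt B x
  w≡⇔scaledWeightAt≡ A B x = weight-≡⇔ m (sphereCount A x 0) (sphereCount A x 1) (sphereCount A x 2)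
                                          (sphereCount B x 0) (sphereCount B x 1) (sphereCount B x 2)

  w≤1⇔scaledWeightAt≤n : ∀ Z x → w Z x ℚ.≤ ι 1 ⇔ scaledWeightAt Z x ≤ suc m
  w≤1⇔scaledWeightAt≤n Z x = weight-≤1⇔ m (sphereCount Z x 0) (sphereCount Z x 1) (sphereCount Z x 2)

  scaledWeightAt-ballCount : ∀ Z x → scaledWeightAt Z x ≡ suc m * ballCount Z x + 2 * sphereCount Z x 2
  scaledWeightAt-ballCount Z x =
    cong (λ b → suc m * b + 2 * sphereCount Z x 2) (sym (ballCount≡sphereCount₀+sphereCount₁ Z x))

  code⇒scaledWeightAt≡n : ∀ {Z : VSet q (suc m)} → IsCode 4 Z → ∀ x → BallMeets Z x →
                          scaledWeightAt Z x ≡ suc m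
  code⇒scaledWeightAt≡n {Z} code x meets = begin
    scaledWeightAt Z x                             ≡⟨ scaledWeightAt-ballCount Z x ⟩
    suc m * ballCount Z x + 2 * sphereCount Z x 2 ≡⟨ cong₂ (λ b c → suc m * b + 2 * c) (code⇒ballCount≡1 code x meets)
                                                          (code⇒sphereCount₂≡0 code x meets) ⟩
    suc m * 1 + 0                                  ≡⟨ trans (ℕ.+-identityʳ (suc m * 1)) (ℕ.*-identityʳ (suc m)) ⟩
    suc m                                          ∎
    where open ≡-Reasoning

  code⇒scaledWeightAt≡coverage : ∀ {Z : VSet q (suc m)} → IsCode 4 Z → ∀ x → ¬ BallMeets Z x →
                                 scaledWeightAt Z x ≡ coverage Z x
  code⇒scaledWeightAt≡coverage {Z} code x empty = begin
    scaledWeightAt Z x                             ≡⟨ scaledWeightAt-ballCount Z x ⟩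
    suc m * ballCount Z x + 2 * sphereCount Z x 2 ≡⟨ cong (λ b → suc m * b + 2 * sphereCount Z x 2)
                                                         (¬ballMeets⇒ballCount≡0 Z x empty) ⟩
    suc m * 0 + 2 * sphereCount Z x 2             ≡⟨ cong (_+ 2 * sphereCount Z x 2) (ℕ.*-zeroʳ (suc m)) ⟩
    2 * sphereCount Z x 2                         ≡⟨ code⇒coverage≡2*sphereCount₂ code x ⟨
    coverage Z x                                   ∎
    where open ≡-Reasoning

  code⇒scaledWeightAt≤n : ∀ {Z : VSet q (suc m)} → IsCode 4 Z → ∀ x → scaledWeightAt Z x ≤ suc m
  code⇒scaledWeightAt≤n {Z} code x with ballMeets? Z x
  ... | yes meets = ℕ.≤-reflexive (code⇒scaledWeightAt≡n code x meets)
  ... | no  empty = ℕ.≤-trans (ℕ.≤-reflexive (code⇒scaledWeightAt≡coverage code x empty)) (coverage≤n Z x)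

  -- The neighbour x of t one step towards t′ has t in its ball and t′ in its ball or on
  -- its sphere of radius 2.
  close-pair⇒overweight : ∀ {Z : VSet q (suc m)} {t t′} → Z t ≡ true → Z t′ ≡ true → t ≢ t′ →
                          dist t t′ ≤ 3 → Σ[ x ∈ V q (suc m) ] suc m < scaledWeightAt Z x
  close-pair⇒overweight {Z} {t} {t′} zt zt′ t≢t′ d≤3 with x , dxt , dtt′ ← step-towards t t′ t≢t′ =
    x , subst (suc m <_) (sym (scaledWeightAt-ballCount Z x)) overweight
    where
    k≤2 : dist x t′ ≤ 2
    k≤2 = ℕ.≤-pred (subst (_≤ 3) dtt′ d≤3)
    t∈ball : ballMember Z x t ≡ true
    t∈ball = ballMember-intro Z x t zt (ℕ.≤-reflexive dxt)
    overweight : suc m < suc m * ballCount Z x + 2 * sphereCount Z x 2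
    overweight with dist x t′ ℕ.≤? 1
    ... | yes k≤1 = n<scaledWeight-of-2≤ball m (ballCount Z x) (sphereCount Z x 2)
      (count-≥2 (allV q (suc m)) (ballMember Z x) (allV-unique (suc m)) (∈-allV t) (∈-allV t′) t≢t′
                t∈ball (ballMember-intro Z x t′ zt′ k≤1))
    ... | no  k≰1 = n<scaledWeight-of-1≤ball-1≤sphere m (ballCount Z x) (sphereCount Z x 2)
      (count-pos (ballMember Z x) (∈-allV t) t∈ball)
      (count-pos (sphereMember Z x 2) (∈-allV t′)
                 (sphereMember-intro Z x 2 t′ zt′ (ℕ.≤-antisym k≤2 (ℕ.≰⇒> k≰1))))

  scaledWeightAt≤n⇒code : ∀ {Z : VSet q (suc m)} → (∀ x → scaledWeightAt Z x ≤ suc m) → IsCode 4 Z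
  scaledWeightAt≤n⇒code bounded t t′ zt zt′ t≢t′ with 4 ℕ.≤? dist t t′
  ... | yes 4≤d = 4≤d
  ... | no  4≰d with x , overweight ← close-pair⇒overweight zt zt′ t≢t′ (ℕ.≤-pred (ℕ.≰⇒> 4≰d)) =
    ⊥-elim (ℕ.<⇒≱ overweight (bounded x))

both-bits-set : ∀ {a b} → a ≤ 1 → b ≤ 1 → ¬ a + b ≤ 1 → a ≡ 1 × b ≡ 1
both-bits-set z≤n       b≤1       a+b≰1 = ⊥-elim (a+b≰1 b≤1)
both-bits-set (s≤s z≤n) z≤n       a+b≰1 = ⊥-elim (a+b≰1 (s≤s z≤n))
both-bits-set (s≤s z≤n) (s≤s z≤n) _     = refl , refl

-- Projections

module _ {q m : ℕ} where

  ProjMeets : VSet q (suc m) → Fin (suc m) → V q m → Set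
  ProjMeets T i = BallMeets (proj i T)

  proj-witness : ∀ i (C : VSet q (suc m)) z → proj i C z ≡ true → Σ[ a ∈ Fin q ] C (insertAt z i a) ≡ true
  proj-witness i C z p with a , _ , ca ← any-witness (λ a → C (insertAt z i a)) (allFin q) p = a , ca

  proj-insertAt : ∀ i (C : VSet q (suc m)) {z} a → C (insertAt z i a) ≡ true → proj i C z ≡ true
  proj-insertAt i C {z} a ca = any-of-witness (λ a → C (insertAt z i a)) (∈-allFin a) ca

  proj-removeAt : ∀ i (C : VSet q (suc m)) {t} → C t ≡ true → proj i C (removeAt t i) ≡ true
  proj-removeAt i C {t} ct = proj-insertAt i C (lookup t i) (subst (λ v → C v ≡ true) (sym (insertAt-removeAt t i)) ct)

  projPair-elim : ∀ i (A B : VSet q (suc m)) z → projPair₊ i A B z ≡ true →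
                  proj i A z ≡ true × proj i B z ≡ false
  projPair-elim i A B z p with proj i A z | proj i B z
  ... | true  | false = refl , refl
  ... | true  | true  with () ← p
  ... | false | _     with () ← p

  projPair-intro : ∀ i (A B : VSet q (suc m)) {z} → proj i A z ≡ true → proj i B z ≡ false →
                   projPair₊ i A B z ≡ true
  projPair-intro i A B pa pb rewrite pa | pb = refl

  code⇒projMeets-unique : ∀ {T : VSet q (suc m)} → IsCode 4 T → ∀ {i} y (h h′ : ProjMeets T i y) →
                          proj₁ h ≡ proj₁ h′
  code⇒projMeets-unique {T} code {i} y (z , pz , d) (z′ , pz′ , d′)
    with a , ta ← proj-witness i T z pz | a′ , ta′ ← proj-witness i T z′ pz′ = begin
      z                             ≡⟨ removeAt-insertAt z i a ⟨
      removeAt (insertAt z i a) i   ≡⟨ cong (λ t → removeAt t i) (code-≤3⇒≡ code ta ta′ close) ⟩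
      removeAt (insertAt z′ i a′) i ≡⟨ removeAt-insertAt z′ i a′ ⟩
      z′                            ∎
    where
    open ≡-Reasoning
    close : dist (insertAt z i a) (insertAt z′ i a′) ≤ 3
    close = ℕ.≤-trans (ℕ.≤-reflexive (dist-insertAt z z′ i a a′))
      (ℕ.+-mono-≤ (coordDist-≤1 a a′)
        (ℕ.≤-trans (dist-triangle z y z′) (ℕ.+-mono-≤ (ℕ.≤-trans (ℕ.≤-reflexive (dist-sym z y)) d) d′)))

  projPairBall-transfer : ∀ i (A B : VSet q (suc m)) →
                          (∀ y → ballCount (projPair₊ i A B) y ≡ ballCount (projPair₋ i A B) y) →
                          ∀ y → ProjMeets A i y → ProjMeets B i y
  projPairBall-transfer i A B balanced y (z , pa , d) with proj i B z in pb
  ... | true  = z , pb , d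
  ... | false =
    let z′ , _ , p = count-pos-witness (allV q m) (ballMember (projPair₋ i A B) y)
                                       (subst (1 ≤_) (balanced y) z∈ball₊)
        p₋ , d′    = ballMember-elim (projPair₋ i A B) y z′ p
    in z′ , proj₁ (projPair-elim i B A z′ p₋) , d′
    where
    z∈ball₊ : 1 ≤ ballCount (projPair₊ i A B) y
    z∈ball₊ = count-pos (ballMember (projPair₊ i A B) y) (∈-allV z)
                (ballMember-intro (projPair₊ i A B) y z (projPair-intro i A B pa pb) d)

  ¬projMeets⇒projPairBall≡0 : ∀ i (A B : VSet q (suc m)) y → ¬ ProjMeets A i y →
                              ballCount (projPair₊ i A B) y ≡ 0
  ¬projMeets⇒projPairBall≡0 i A B y ¬meets =
    count-none (allV q m) (ballMember (projPair₊ i A B) y) λ z p →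
    let p₊ , d = ballMember-elim (projPair₊ i A B) y z p
    in ¬meets (z , proj₁ (projPair-elim i A B z p₊) , d)

  sameCentre⇒projPairBall≡0 : ∀ i (A B : VSet q (suc m)) y → IsCode 4 A →
                              (hA : ProjMeets A i y) (hB : ProjMeets B i y) →
                              proj₁ hA ≡ proj₁ hB → ballCount (projPair₊ i A B) y ≡ 0
  sameCentre⇒projPairBall≡0 i A B y codeA hA (zB , pb , _) same =
    count-none (allV q m) (ballMember (projPair₊ i A B) y) λ z p →
    let p₊ , d    = ballMember-elim (projPair₊ i A B) y z p
        pa , ¬pb  = projPair-elim i A B z p₊
        z≡zB      = trans (code⇒projMeets-unique codeA y (z , pa , d) hA) same
    in false≢true (trans (sym ¬pb) (subst (λ v → proj i B v ≡ true) (sym z≡zB) pb))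

  differentCentres⇒projPairBall≡1 : ∀ i (A B : VSet q (suc m)) y → IsCode 4 A → IsCode 4 B →
                                    (hA : ProjMeets A i y) (hB : ProjMeets B i y) →
                                    proj₁ hA ≢ proj₁ hB → ballCount (projPair₊ i A B) y ≡ 1
  differentCentres⇒projPairBall≡1 i A B y codeA codeB hA@(zA , pa , d) hB different =
    count-≡1 (allV q m) (ballMember (projPair₊ i A B) y) (allV-unique m) (∈-allV zA)
      (ballMember-intro (projPair₊ i A B) y zA (projPair-intro i A B pa zA∉B) d) unique
    where
    zA∉B : proj i B zA ≡ false
    zA∉B with proj i B zA in pb
    ... | false = refl
    ... | true  = ⊥-elim (different (code⇒projMeets-unique codeB y (zA , pb , d) hB))
    unique : ∀ z → ballMember (projPair₊ i A B) y z ≡ true → z ≡ zA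
    unique z p = let p₊ , d′ = ballMember-elim (projPair₊ i A B) y z p
                 in code⇒projMeets-unique codeA y (z , proj₁ (projPair-elim i A B z p₊) , d′) hA

  perfectBitrade⇔sameProjMeetsAt : ∀ {A B : VSet q (suc m)} → IsCode 4 A → IsCode 4 B → ∀ i →
                                   PerfectBitrade (projPair₊ i A B) (projPair₋ i A B) ⇔
                                   (∀ y → ProjMeets A i y ⇔ ProjMeets B i y)
  perfectBitrade⇔sameProjMeetsAt {A} {B} codeA codeB i = mk⇔ transfer bitrade
    where
    P₊ P₋ : VSet q m
    P₊ = projPair₊ i A B
    P₋ = projPair₋ i A B

    BalancedAt : V q m → Set
    BalancedAt y = (ballCount P₊ y ≡ ballCount P₋ y) × (ballCount P₊ y ≤ 1)

    transfer : PerfectBitrade P₊ P₋ → ∀ y → ProjMeets A i y ⇔ ProjMeets B i y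
    transfer (_ , balanced) y = mk⇔ (projPairBall-transfer i A B (λ y → proj₁ (balanced y)) y)
                                     (projPairBall-transfer i B A (λ y → sym (proj₁ (balanced y))) y)

    balancedAt : ∀ y {k} → ballCount P₊ y ≡ k → ballCount P₋ y ≡ k → k ≤ 1 → BalancedAt y
    balancedAt y e₊ e₋ k≤1 = trans e₊ (sym e₋) , subst (_≤ 1) (sym e₊) k≤1

    bitrade : (∀ y → ProjMeets A i y ⇔ ProjMeets B i y) → PerfectBitrade P₊ P₋
    bitrade same = disjoint , balanced
      where
      disjoint : Disjoint P₊ P₋
      disjoint z (p₊ , p₋) =
        false≢true (trans (sym (proj₂ (projPair-elim i A B z p₊))) (proj₁ (projPair-elim i B A z p₋)))
      balanced : ∀ y → BalancedAt y
      balanced y with ballMeets? (proj i A) y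
      ... | no ¬hA = balancedAt y (¬projMeets⇒projPairBall≡0 i A B y ¬hA)
                                  (¬projMeets⇒projPairBall≡0 i B A y (¬hA ∘ from (same y))) z≤n
      ... | yes hA with hB ← to (same y) hA | ≡-dec _≟_ (proj₁ hA) (proj₁ hB)
      ... | yes same-centre = balancedAt y
        (sameCentre⇒projPairBall≡0 i A B y codeA hA hB same-centre)
        (sameCentre⇒projPairBall≡0 i B A y codeB hB hA (sym same-centre)) z≤n
      ... | no  different   = balancedAt y
        (differentCentres⇒projPairBall≡1 i A B y codeA codeB hA hB different)
        (differentCentres⇒projPairBall≡1 i B A y codeB codeA hB hA (different ∘ sym)) ℕ.≤-refl

  ballMeets⇒projMeets : ∀ {Z : VSet q (suc m)} x → BallMeets Z x → ∀ i → ProjMeets Z i (removeAt x i)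
  ballMeets⇒projMeets {Z} x (t , zt , d) i =
    removeAt t i , proj-removeAt i Z zt , ℕ.≤-trans (dist-removeAt-≤ x t i) d

  covered⇔projMeets : ∀ (Z : VSet q (suc m)) x i → ¬ BallMeets Z x →
                      covered Z x i ≡ true ⇔ ProjMeets Z i (removeAt x i)
  covered⇔projMeets Z x i empty = mk⇔ covered⇒meets meets⇒covered
    where
    covered⇒meets : covered Z x i ≡ true → ProjMeets Z i (removeAt x i)
    covered⇒meets c with t , t∈ , dt ← any-witness (λ t → differ (lookup x i) (lookup t i)) (sphere₂ Z x) c =
      removeAt t i , proj-removeAt i Z (proj₁ (∈-sphere₂⁻ Z x t∈)) ,
      ℕ.≤-reflexive (ℕ.suc-injective
        (trans (sym (dist-removeAt-differ x t i dt)) (proj₂ (∈-sphere₂⁻ Z x t∈))))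

    -- The codeword found lies outside B(x) but within distance 1 of x off coordinate i,
    -- so it is at distance 2 from x and differs from x at i.
    meets⇒covered : ProjMeets Z i (removeAt x i) → covered Z x i ≡ true
    meets⇒covered (z , pz , d) with a , za ← proj-witness i Z z pz
      with cd≡1 , r≡1 ← both-bits-set (coordDist-≤1 (lookup x i) a) d
                          (λ close → empty (insertAt z i a , za , subst (_≤ 1) (sym (dist-insertAtʳ x z i a)) close)) =
      any-of-witness (λ t → differ (lookup x i) (lookup t i))
        (∈-sphere₂⁺ Z x za (trans (dist-insertAtʳ x z i a) (cong₂ _+_ cd≡1 r≡1)))
        (coordDist≡1⇒differ (lookup x i) (lookup (insertAt z i a) i)
          (subst (λ b → coordDist (lookup x i) b ≡ 1) (sym (insertAt-lookup z i a)) cd≡1))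

  SameProjMeets : VSet q (suc m) → VSet q (suc m) → Set
  SameProjMeets A B = ∀ i y → ProjMeets A i y ⇔ ProjMeets B i y

  code⇒scaledWeightAt≡n-of-projMeets : ∀ {Z : VSet q (suc m)} → IsCode 4 Z → ∀ x → ¬ BallMeets Z x →
                                        (∀ i → ProjMeets Z i (removeAt x i)) → scaledWeightAt Z x ≡ suc m
  code⇒scaledWeightAt≡n-of-projMeets {Z} code x empty meets = begin
    scaledWeightAt Z x        ≡⟨ code⇒scaledWeightAt≡coverage code x empty ⟩
    coverage Z x              ≡⟨ count-every (allFin (suc m)) (covered Z x)
                                   (λ i → from (covered⇔projMeets Z x i empty) (meets i)) ⟩
    length (allFin (suc m))   ≡⟨ length-tabulate {n = suc m} (λ i → i) ⟩
    suc m                     ∎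
    where open ≡-Reasoning

  sameProjMeets⇒scaledWeightAt≡ : ∀ {A B : VSet q (suc m)} → IsCode 4 A → IsCode 4 B → SameProjMeets A B →
                                   ∀ x → scaledWeightAt A x ≡ scaledWeightAt B x
  sameProjMeets⇒scaledWeightAt≡ {A} {B} codeA codeB same x with ballMeets? A x | ballMeets? B x
  ... | yes ballA | yes ballB =
    trans (code⇒scaledWeightAt≡n codeA x ballA) (sym (code⇒scaledWeightAt≡n codeB x ballB))
  ... | yes ballA | no  emptyB = trans (code⇒scaledWeightAt≡n codeA x ballA)
    (sym (code⇒scaledWeightAt≡n-of-projMeets codeB x emptyB
           (λ i → to (same i (removeAt x i)) (ballMeets⇒projMeets x ballA i))))
  ... | no  emptyA | yes ballB = trans
    (code⇒scaledWeightAt≡n-of-projMeets codeA x emptyA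
      (λ i → from (same i (removeAt x i)) (ballMeets⇒projMeets x ballB i)))
    (sym (code⇒scaledWeightAt≡n codeB x ballB))
  ... | no  emptyA | no  emptyB = begin
    scaledWeightAt A x ≡⟨ code⇒scaledWeightAt≡coverage codeA x emptyA ⟩
    coverage A x       ≡⟨ count-cong (allFin (suc m)) (covered A x) (covered B x) (λ i →
                            ⇔-trans (covered⇔projMeets A x i emptyA)
                                    (⇔-trans (same i (removeAt x i)) (⇔-sym (covered⇔projMeets B x i emptyB)))) ⟩
    coverage B x       ≡⟨ code⇒scaledWeightAt≡coverage codeB x emptyB ⟨
    scaledWeightAt B x ∎
    where open ≡-Reasoning

  scaledWeightAt≡⇒projMeets-transfer : ∀ {A B : VSet q (suc m)} → IsCode 4 A → IsCode 4 B →
                                        (∀ x → scaledWeightAt A x ≡ scaledWeightAt B x) →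
                                        ∀ i y → ProjMeets A i y → ProjMeets B i y
  scaledWeightAt≡⇒projMeets-transfer {A} {B} codeA codeB equal i y (z , pz , d) with a , za ← proj-witness i A z pz =
    subst (ProjMeets B i) (removeAt-insertAt y i a) meetsB
    where
    x : V q (suc m)
    x = insertAt y i a
    ballA : BallMeets A x
    ballA = insertAt z i a , za ,
      ℕ.≤-trans (ℕ.≤-reflexive (trans (dist-insertAt y z i a a) (cong (_+ dist y z) (coordDist-self a)))) d
    -- When the ball around x misses B, equal weights force every coordinate to be covered.
    meetsB : ProjMeets B i (removeAt x i)
    meetsB with ballMeets? B x
    ... | yes ballB = ballMeets⇒projMeets x ballB i
    ... | no  emptyB = to (covered⇔projMeets B x i emptyB)
      (count-≡length⇒every (allFin (suc m)) (covered B x) full (∈-allFin i))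
      where
      full : coverage B x ≡ length (allFin (suc m))
      full = begin
        coverage B x            ≡⟨ code⇒scaledWeightAt≡coverage codeB x emptyB ⟨
        scaledWeightAt B x      ≡⟨ equal x ⟨
        scaledWeightAt A x      ≡⟨ code⇒scaledWeightAt≡n codeA x ballA ⟩
        suc m                   ≡⟨ length-tabulate {n = suc m} (λ i → i) ⟨
        length (allFin (suc m)) ∎
        where open ≡-Reasoning

  sameProjMeets⇔scaledWeightAt≡ : ∀ {A B : VSet q (suc m)} → IsCode 4 A → IsCode 4 B →
                                   SameProjMeets A B ⇔ (∀ x → scaledWeightAt A x ≡ scaledWeightAt B x)
  sameProjMeets⇔scaledWeightAt≡ codeA codeB = mk⇔ (sameProjMeets⇒scaledWeightAt≡ codeA codeB) λ equal i y →
    mk⇔ (scaledWeightAt≡⇒projMeets-transfer codeA codeB equal i y)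
        (scaledWeightAt≡⇒projMeets-transfer codeB codeA (λ x → sym (equal x)) i y)

proposition1 : (q m : ℕ) → 3 ≤ q → (T₊ T₋ : VSet q (suc m)) → Disjoint T₊ T₋ →
    (D2 T₊ T₋ ⇔ D3 T₊ T₋)
proposition1 q m _ T₊ T₋ _ = mk⇔ D2⇒D3 D3⇒D2
  where
  D2⇒D3 : D2 T₊ T₋ → D3 T₊ T₋
  D2⇒D3 (code₊ , code₋ , bitrades) x =
    from (w≡⇔scaledWeightAt≡ T₊ T₋ x) (to (sameProjMeets⇔scaledWeightAt≡ code₊ code₋) same x) ,
    from (w≤1⇔scaledWeightAt≤n T₊ x) (code⇒scaledWeightAt≤n code₊ x)
    where
    same : SameProjMeets T₊ T₋
    same i = to (perfectBitrade⇔sameProjMeetsAt code₊ code₋ i) (bitrades i)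

  D3⇒D2 : D3 T₊ T₋ → D2 T₊ T₋
  D3⇒D2 d3 = code₊ , code₋ , λ i →
    from (perfectBitrade⇔sameProjMeetsAt code₊ code₋ i)
         (from (sameProjMeets⇔scaledWeightAt≡ code₊ code₋) equal i)
    where
    equal : ∀ x → scaledWeightAt T₊ x ≡ scaledWeightAt T₋ x
    equal x = to (w≡⇔scaledWeightAt≡ T₊ T₋ x) (proj₁ (d3 x))
    bounded₊ : ∀ x → scaledWeightAt T₊ x ≤ suc m
    bounded₊ x = to (w≤1⇔scaledWeightAt≤n T₊ x) (proj₂ (d3 x))
    code₊ : IsCode 4 T₊
    code₊ = scaledWeightAt≤n⇒code bounded₊
    code₋ : IsCode 4 T₋
    code₋ = scaledWeightAt≤n⇒code (λ x → subst (_≤ suc m) (equal x) (bounded₊ x))
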